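{- Let $d\ge3$ be an integer and let $I$ be an instance of \textsc{$d$-Constraint-Cover} with parameter $k$, variable set $X$, full set $\mathcal{C}^0$, and constraint sets $\mathcal{C}^1,\mathcal{C}^2$. Let $H'=(V',E')$ be the hypergraph constructed from $I$ as described in the context. Then $H'$ is $d$-square-free.
   Context: Let $X$ be a set. A $0$-constraint over $X$ is an equality $(x=a)$ with $x\in X$, $a\in\{0,1\}$, with $V((x=a))=\{x\}$. For $i>0$, an $i$-constraint is a set $C$ of $(i-1)$-constraints whose variable sets $V(\cdot)$ are pairwise disjoint, with $V(C)$ the union of these. The full set of $0$-constraints is $\mathcal{C}^0=\{(x=a):x\in X,a\in\{0,1\}\}$. An instance of \textsc{$d$-Constraint-Cover} consists of a parameter $k$, a set $X$ of $d^2k$ variables, $\mathcal{C}^0$, a set $\mathcal{C}^1$ of $1$-constraints over $X$ each with at most $d$ elements, and a set $\mathcal{C}^2$ of $2$-constraints over $X$ each consisting of exactly $d$ elements of $\mathcal{C}^1$. The hypergraph $H'=(V',E')$: $V'$ consists of vertices $v^1_x$ ($x\in X$), $v^2_{x,a}$ ($x\in X$, $a\in\{0,1\}$), $v^3_C$ ($C\in\mathcal{C}^1$). $E'$ consists of: for $x\in X$, $a\in\{0,1\}$, the edge $e^1_{x,a}=\{v^1_x,v^2_{x,a}\}\cup\{v^3_C: C\in\mathcal{C}^1,\ (x=a)\in C\}$; for $C\in\mathcal{C}^1$, the edge $e^2_C=\{v^2_{x,a}:(x=a)\in C\}$; for $C\in\mathcal{C}^2$, the edge $e^3_C=\{v^3_{C'}:C'\in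 C\}$. A $d$-square in a hypergraph $(V',E')$ is a pair $(W,F)$ with $W=\{w_1,\ldots,w_d\}\subseteq V'$ consisting of $d$ distinct vertices and $F=\{f_1,\ldots,f_d\}\subseteq E'$ consisting of $d$ distinct edges, such that $w_i\in f_j$ for all $(i,j)\in[d]\times[d]$ with $i\le2$ or $j\le2$. The hypergraph is $d$-square-free if it contains no $d$-square. -}

module Defs where

open import Data.Nat using (ℕ; _*_; _≤_; _<_)
open import Data.Bool using (Bool)
open import Data.Fin using (Fin; toℕ)
open import Data.Fin.Subset using (Subset; ∣_∣; _∈_)
open import Data.Maybe using (Maybe; just; is-just)
open import Data.Vec using (tabulate)
open import Data.Product using (Σ; _×_)
open import Data.Sum using (_⊎_)
open import Data.Empty using (⊥)
open import Relation.Nullary using (¬_)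
open import Relation.Binary.PropositionalEquality using (_≡_; _≢_)
open import Function.Definitions using (Injective)

record Hypergraph : Set₁ where
  field
    Vertex : Set
    Edge   : Set
    _∈ₑ_   : Vertex → Edge → Set

-- A d-square (W, F): d distinct vertices w_1..w_d and d distinct edges
-- f_1..f_d with w_i ∈ f_j whenever i ≤ 2 or j ≤ 2 (indices 1..d are
-- represented by Fin d, i.e. 0..d-1, so "i ≤ 2" becomes "toℕ i < 2").
record Square (d : ℕ) (H : Hypergraph) : Set where
  open Hypergraph H
  field
    W     : Fin d → Vertex
    F     : Fin d → Edge
    W-inj : Injective _≡_ _≡_ W
    F-inj : Injective _≡_ _≡_ F
    inc   : ∀ i j → (toℕ i < 2 ⊎ toℕ j < 2) → W i ∈ₑ F j

SquareFree : ℕ → Hypergraph → Set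
SquareFree d H = ¬ Square d H

-- A 1-constraint over X = Fin n: a set of 0-constraints (x = a) with
-- pairwise disjoint variable sets, i.e. at most one value per variable.
-- It is represented as a partial assignment: (x = a) ∈ C  iff  C x ≡ just a.
OneConstraint : ℕ → Set
OneConstraint n = Fin n → Maybe Bool

size₁ : ∀ {n} → OneConstraint n → ℕ
size₁ C = ∣ tabulate (λ x → is-just (C x)) ∣

Disjoint₁ : ∀ {n} → OneConstraint n → OneConstraint n → Set
Disjoint₁ C D = ∀ x a b → C x ≡ just a → D x ≡ just b → ⊥

-- Variables X = Fin (d * d * k); C⁰ is implicit (all (x = a)).
-- C¹ is the family C1 : Fin m1 → OneConstraint, injective (so it is a set);
-- C² is the family C2 : Fin m2 → Subset m1 (sets of elements of C¹),
-- injective, each of exactly d elements with pairwise disjoint variable sets.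
record Instance (d : ℕ) : Set where
  field
    k    : ℕ
    m1   : ℕ
    C1   : Fin m1 → OneConstraint (d * d * k)
    C1-inj  : ∀ i j → i ≢ j → ¬ (∀ x → C1 i x ≡ C1 j x)
    C1-size : ∀ i → size₁ (C1 i) ≤ d
    m2   : ℕ
    C2   : Fin m2 → Subset m1
    C2-inj  : Injective _≡_ _≡_ C2
    C2-size : ∀ i → ∣ C2 i ∣ ≡ d
    C2-disj : ∀ i c c' → c ∈ C2 i → c' ∈ C2 i → c ≢ c' → Disjoint₁ (C1 c) (C1 c')

module Construction {d : ℕ} (I : Instance d) where
  open Instance I

  n : ℕ
  n = d * d * k

  data V' : Set where
    v¹ : Fin n → V'
    v² : Fin n → Bool → V'
    v³ : Fin m1 → V'

  data E' : Set where
    e¹ : Fin n → Bool → E'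
    e² : Fin m1 → E'
    e³ : Fin m2 → E'

  _∈'_ : V' → E' → Set
  v¹ y   ∈' e¹ x a = y ≡ x
  v² y b ∈' e¹ x a = (y ≡ x) × (b ≡ a)
  v³ c   ∈' e¹ x a = C1 c x ≡ just a
  v¹ _   ∈' e² _   = ⊥
  v² y b ∈' e² c   = C1 c y ≡ just b
  v³ _   ∈' e² _   = ⊥
  v¹ _   ∈' e³ _   = ⊥
  v² _ _ ∈' e³ _   = ⊥
  v³ c   ∈' e³ C   = c ∈ C2 C

H' : ∀ {d} → Instance d → Hypergraph
H' I = record { Vertex = V' ; Edge = E' ; _∈ₑ_ = _∈'_ }
  where open Construction I

-- In a d-square the first two vertices share d ≥ 3 edges and the first two
-- edges share d vertices.  A vertex v¹ lies in only two edges, and a v² and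
-- a v³ share at most one edge.  Two distinct v²'s share only e²-edges; two
-- v³'s share only e¹-edges if their 1-constraints overlap and only e³-edges
-- if they are disjoint.  In the remaining cases the d shared incidences are
-- d distinct points common to two labels (1- or 2-constraints) of size ≤ d,
-- so the labels contain exactly these points and coincide.
module Submission where

open import Defs
open import Data.Nat using (ℕ; zero; suc; _+_; _≤_; z≤n; s≤s)
open import Data.Nat.Properties using (≤-trans; ≤⇒≯; ≤-reflexive)
open import Data.Bool using (Bool; true; false)
open import Data.Fin using (Fin; zero; suc; #_; _≟_)
open import Data.Fin.Properties using (any?; suc-injective; 0≢1+n)
open import Data.Fin.Subset using (Subset; ∣_∣; _∈_; _-_; _⊆_)
open import Data.Fin.Subset.Properties using (x∈p⇒∣p-x∣<∣p∣; x∈p∧x≢y⇒x∈p-y; ⊆-antisym)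
open import Data.Maybe using (just; nothing; is-just)
open import Data.Maybe.Properties using (just-injective)
open import Data.Vec using (tabulate)
open import Data.Vec.Properties using (lookup∘tabulate; lookup⇒[]=)
open import Data.Product using (Σ; _×_; _,_; proj₁; proj₂)
open import Data.Product.Properties using (×-≡,≡→≡)
open import Data.Sum using (_⊎_; inj₁; inj₂; [_,_]′)
open import Data.Empty using (⊥; ⊥-elim)
open import Function using (_∘_)
open import Function.Definitions using (Injective)
open import Relation.Nullary using (yes; no)
open import Relation.Nullary.Decidable using (decidable-stable)
open import Relation.Binary.PropositionalEquality
  using (_≡_; _≢_; refl; sym; trans; cong; subst; module ≡-Reasoning)

private
  variable
    A B : Set
    d m N : ℕ

injection⇒≤∣∣ : (S : Subset N) (g : Fin m → Fin N) → Injective _≡_ _≡_ g →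
                (∀ i → g i ∈ S) → m ≤ ∣ S ∣
injection⇒≤∣∣ {m = zero}  S g g-inj g∈S = z≤n
injection⇒≤∣∣ {m = suc m} S g g-inj g∈S =
  ≤-trans (s≤s (injection⇒≤∣∣ (S - g zero) (g ∘ suc) (suc-injective ∘ g-inj) g∘suc∈S-g₀))
          (x∈p⇒∣p-x∣<∣p∣ (g∈S zero))
  where
  g∘suc∈S-g₀ : ∀ i → g (suc i) ∈ S - g zero
  g∘suc∈S-g₀ i = x∈p∧x≢y⇒x∈p-y (g∈S (suc i)) (0≢1+n ∘ sym ∘ g-inj)

injection-onto : (S : Subset N) → ∣ S ∣ ≤ d → (g : Fin d → Fin N) → Injective _≡_ _≡_ g →
                 (∀ i → g i ∈ S) → ∀ {y} → y ∈ S → Σ (Fin d) λ i → g i ≡ y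
injection-onto {N} {d} S ∣S∣≤d g g-inj g∈S {y} y∈S with any? (λ i → g i ≟ y)
... | yes hit = hit
... | no miss = ⊥-elim (≤⇒≯ ∣S∣≤d (injection⇒≤∣∣ S g′ g′-inj g′∈S))
  where
  g′ : Fin (suc d) → Fin N
  g′ zero    = y
  g′ (suc i) = g i

  g′-inj : Injective _≡_ _≡_ g′
  g′-inj {zero}  {zero}  _  = refl
  g′-inj {zero}  {suc j} eq = ⊥-elim (miss (j , sym eq))
  g′-inj {suc i} {zero}  eq = ⊥-elim (miss (i , eq))
  g′-inj {suc i} {suc j} eq = cong suc (g-inj eq)

  g′∈S : ∀ i → g′ i ∈ S
  g′∈S zero    = y∈S
  g′∈S (suc i) = g∈S i

⊆-of-common-points : (S T : Subset N) → ∣ S ∣ ≤ d → (g : Fin d → Fin N) →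
                     Injective _≡_ _≡_ g → (∀ i → g i ∈ S) → (∀ i → g i ∈ T) → S ⊆ T
⊆-of-common-points S T ∣S∣≤d g g-inj g∈S g∈T y∈S
  with injection-onto S ∣S∣≤d g g-inj g∈S y∈S
... | i , refl = g∈T i

injective-preimages : (g : A → B) {W : Fin d → B} → Injective _≡_ _≡_ W →
                      (∀ i → Σ A λ a → W i ≡ g a) →
                      Σ (Fin d → A) λ p → Injective _≡_ _≡_ p × (∀ i → W i ≡ g (p i))
injective-preimages g W-inj pre =
  proj₁ ∘ pre ,
  (λ {i} {j} eq → W-inj (trans (proj₂ (pre i)) (trans (cong g eq) (sym (proj₂ (pre j)))))) ,
  proj₂ ∘ pre

_∋_ : OneConstraint N → Fin N × Bool → Set
c ∋ (x , a) = c x ≡ just a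

support : OneConstraint N → Subset N
support c = tabulate (is-just ∘ c)

∋⇒∈support : (c : OneConstraint N) {x : Fin N} {a : Bool} → c ∋ (x , a) → x ∈ support c
∋⇒∈support c {x} cx≡a = lookup⇒[]= x (support c) (trans (lookup∘tabulate _ x) (cong is-just cx≡a))

variables-injective : (c : OneConstraint N) (p : Fin d → Fin N × Bool) →
                      Injective _≡_ _≡_ p → (∀ i → c ∋ p i) → Injective _≡_ _≡_ (proj₁ ∘ p)
variables-injective c p p-inj c∋p {i} {j} xᵢ≡xⱼ =
  p-inj (×-≡,≡→≡ (xᵢ≡xⱼ , just-injective (trans (sym (c∋p i)) (trans (cong c xᵢ≡xⱼ) (c∋p j)))))

extends-of-common-points : (c c′ : OneConstraint N) → size₁ c ≤ d →
                           (p : Fin d → Fin N × Bool) → Injective _≡_ _≡_ p →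
                           (∀ i → c ∋ p i) → (∀ i → c′ ∋ p i) → ∀ xa → c ∋ xa → c′ ∋ xa
extends-of-common-points c c′ size≤d p p-inj c∋p c′∋p (x , a) cx≡a
  with injection-onto (support c) size≤d (proj₁ ∘ p) (variables-injective c p p-inj c∋p)
                      (∋⇒∈support c ∘ c∋p) (∋⇒∈support c cx≡a)
... | i , xᵢ≡x = begin
  c′ x              ≡⟨ cong c′ (sym xᵢ≡x) ⟩
  c′ (proj₁ (p i))  ≡⟨ c′∋p i ⟩
  just (proj₂ (p i)) ≡⟨ sym (c∋p i) ⟩
  c (proj₁ (p i))   ≡⟨ cong c xᵢ≡x ⟩
  c x               ≡⟨ cx≡a ⟩
  just a            ∎
  where open ≡-Reasoning

mutual-extension⇒≗ : (c c′ : OneConstraint N) → (∀ xa → c ∋ xa → c′ ∋ xa) →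
                     (∀ xa → c′ ∋ xa → c ∋ xa) → ∀ x → c x ≡ c′ x
mutual-extension⇒≗ c c′ c⊑c′ c′⊑c x with c x in cx | c′ x in c′x
... | just a  | _       = trans (sym (c⊑c′ (x , a) cx)) c′x
... | nothing | just b  = trans (sym cx) (c′⊑c (x , b) c′x)
... | nothing | nothing = refl

≗-of-common-points : (c c′ : OneConstraint N) → size₁ c ≤ d → size₁ c′ ≤ d →
                     (p : Fin d → Fin N × Bool) → Injective _≡_ _≡_ p →
                     (∀ i → c ∋ p i) → (∀ i → c′ ∋ p i) → ∀ x → c x ≡ c′ x
≗-of-common-points c c′ size≤d size′≤d p p-inj c∋p c′∋p =
  mutual-extension⇒≗ c c′ (extends-of-common-points c c′ size≤d p p-inj c∋p c′∋p)
                          (extends-of-common-points c′ c size′≤d p p-inj c′∋p c∋p)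

Bool-pigeonhole : (a b c : Bool) → a ≡ b ⊎ a ≡ c ⊎ b ≡ c
Bool-pigeonhole false false _     = inj₁ refl
Bool-pigeonhole true  true  _     = inj₁ refl
Bool-pigeonhole false true  false = inj₂ (inj₁ refl)
Bool-pigeonhole true  false true  = inj₂ (inj₁ refl)
Bool-pigeonhole false true  true  = inj₂ (inj₂ refl)
Bool-pigeonhole true  false false = inj₂ (inj₂ refl)

module Incidence {d : ℕ} (I : Instance d) where
  open Instance I
  open Construction I

  v²′ : Fin n × Bool → V'
  v²′ (y , b) = v² y b

  e¹′ : Fin n × Bool → E'
  e¹′ (x , a) = e¹ x a

  C1-injective : ∀ {c c′} → (∀ x → C1 c x ≡ C1 c′ x) → c ≡ c′
  C1-injective {c} {c′} C1c≗C1c′ = decidable-stable (c ≟ c′) (λ c≢c′ → C1-inj c c′ c≢c′ C1c≗C1c′)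

  edges-through-v¹ : ∀ {x e e′ e″} → v¹ x ∈' e → v¹ x ∈' e′ → v¹ x ∈' e″ →
                     e ≡ e′ ⊎ e ≡ e″ ⊎ e′ ≡ e″
  edges-through-v¹ {e = e¹ _ a} {e¹ _ a′} {e¹ _ a″} refl refl refl
    with Bool-pigeonhole a a′ a″
  ... | inj₁ refl        = inj₁ refl
  ... | inj₂ (inj₁ refl) = inj₂ (inj₁ refl)
  ... | inj₂ (inj₂ refl) = inj₂ (inj₂ refl)

  edge-through-v²-v³ : ∀ {y b c e} → v² y b ∈' e → v³ c ∈' e → e ≡ e¹ y b
  edge-through-v²-v³ {e = e¹ _ _} (refl , refl) _ = refl

  edge-through-distinct-v² : ∀ {y b y′ b′ e} → v² y b ≢ v² y′ b′ →
                             v² y b ∈' e → v² y′ b′ ∈' e → Σ (Fin m1) λ c → e ≡ e² c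
  edge-through-distinct-v² {e = e¹ _ _} distinct (refl , refl) (refl , refl) = ⊥-elim (distinct refl)
  edge-through-distinct-v² {e = e² c}   _        _             _             = c , refl

  edge-through-v³-v³ : ∀ {c c′ e} → v³ c ∈' e → v³ c′ ∈' e →
                       (Σ (Fin n × Bool) λ xa → e ≡ e¹′ xa × C1 c ∋ xa × C1 c′ ∋ xa) ⊎
                       (Σ (Fin m2) λ C → e ≡ e³ C × c ∈ C2 C × c′ ∈ C2 C)
  edge-through-v³-v³ {e = e¹ x a} c∋xa c′∋xa = inj₁ ((x , a) , refl , c∋xa , c′∋xa)
  edge-through-v³-v³ {e = e³ C}   c∈C  c′∈C  = inj₂ (C , refl , c∈C , c′∈C)

  ∈e²⇒v² : ∀ {v c} → v ∈' e² c → Σ (Fin n × Bool) λ yb → v ≡ v²′ yb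
  ∈e²⇒v² {v² y b} _ = (y , b) , refl

  ∈e³⇒v³ : ∀ {v C} → v ∈' e³ C → Σ (Fin m1) λ c → v ≡ v³ c
  ∈e³⇒v³ {v³ c} _ = c , refl

  e²-rigid : (W : Fin d → V') → Injective _≡_ _≡_ W → ∀ {c c′} →
             (∀ i → W i ∈' e² c) → (∀ i → W i ∈' e² c′) → c ≡ c′
  e²-rigid W W-inj {c} {c′} W∈c W∈c′ with injective-preimages v²′ W-inj (∈e²⇒v² ∘ W∈c)
  ... | p , p-inj , W≡ =
    C1-injective (≗-of-common-points (C1 c) (C1 c′) (C1-size c) (C1-size c′) p p-inj
                   (λ i → subst (_∈' e² c) (W≡ i) (W∈c i)) (λ i → subst (_∈' e² c′) (W≡ i) (W∈c′ i)))

  e³-rigid : (W : Fin d → V') → Injective _≡_ _≡_ W → ∀ {C C′} →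
             (∀ i → W i ∈' e³ C) → (∀ i → W i ∈' e³ C′) → C ≡ C′
  e³-rigid W W-inj {C} {C′} W∈C W∈C′ with injective-preimages v³ W-inj (∈e³⇒v³ ∘ W∈C)
  ... | g , g-inj , W≡ =
    C2-inj (⊆-antisym (⊆-of-common-points (C2 C) (C2 C′) (≤-reflexive (C2-size C)) g g-inj g∈C g∈C′)
                      (⊆-of-common-points (C2 C′) (C2 C) (≤-reflexive (C2-size C′)) g g-inj g∈C′ g∈C))
    where
    g∈C : ∀ i → g i ∈ C2 C
    g∈C i = subst (_∈' e³ C) (W≡ i) (W∈C i)

    g∈C′ : ∀ i → g i ∈ C2 C′
    g∈C′ i = subst (_∈' e³ C′) (W≡ i) (W∈C′ i)

  e¹-rigid : (F : Fin d → E') → Injective _≡_ _≡_ F → (∀ j → Σ (Fin n × Bool) λ xa → F j ≡ e¹′ xa) →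
             ∀ {c c′} → (∀ j → v³ c ∈' F j) → (∀ j → v³ c′ ∈' F j) → c ≡ c′
  e¹-rigid F F-inj F≡e¹ {c} {c′} c∈F c′∈F with injective-preimages e¹′ F-inj F≡e¹
  ... | p , p-inj , F≡ =
    C1-injective (≗-of-common-points (C1 c) (C1 c′) (C1-size c) (C1-size c′) p p-inj
                   (λ j → subst (v³ c ∈'_) (F≡ j) (c∈F j)) (λ j → subst (v³ c′ ∈'_) (F≡ j) (c′∈F j)))

module _ {m : ℕ} (I : Instance (3 + m)) where
  open Instance I
  open Construction I
  open Incidence I

  no-square : SquareFree (3 + m) (H' I)
  no-square sq = no-shared-pair (W (# 0)) (W (# 1)) (W-distinct (λ ())) row₀ row₁
    where
    open Square sq

    W-distinct : ∀ {i j} → i ≢ j → W i ≢ W j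
    W-distinct i≢j = i≢j ∘ W-inj

    F-distinct : ∀ {i j} → i ≢ j → F i ≢ F j
    F-distinct i≢j = i≢j ∘ F-inj

    row₀ : ∀ j → W (# 0) ∈' F j
    row₀ j = inc (# 0) j (inj₁ (s≤s z≤n))

    row₁ : ∀ j → W (# 1) ∈' F j
    row₁ j = inc (# 1) j (inj₁ (s≤s (s≤s z≤n)))

    column₀ : ∀ {e} → F (# 0) ≡ e → ∀ i → W i ∈' e
    column₀ refl i = inc i (# 0) (inj₂ (s≤s z≤n))

    column₁ : ∀ {e} → F (# 1) ≡ e → ∀ i → W i ∈' e
    column₁ refl i = inc i (# 1) (inj₂ (s≤s (s≤s z≤n)))

    columns-distinct : ∀ {e e′} → F (# 0) ≡ e → F (# 1) ≡ e′ → e ≢ e′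
    columns-distinct F₀≡e F₁≡e′ e≡e′ = F-distinct (λ ()) (trans F₀≡e (trans e≡e′ (sym F₁≡e′)))

    no-v¹-row : ∀ {x} → (∀ j → v¹ x ∈' F j) → ⊥
    no-v¹-row x∈F = [ F-distinct (λ ()) , [ F-distinct (λ ()) , F-distinct (λ ()) ]′ ]′
                      (edges-through-v¹ (x∈F (# 0)) (x∈F (# 1)) (x∈F (# 2)))

    no-v³-v³-row : ∀ {c c′} → c ≢ c′ → (∀ j → v³ c ∈' F j) → (∀ j → v³ c′ ∈' F j) → ⊥
    no-v³-v³-row {c} {c′} c≢c′ c∈F c′∈F with edge-through-v³-v³ (c∈F (# 0)) (c′∈F (# 0))
    ... | inj₁ ((x , a) , _ , c∋xa , c′∋xa) = c≢c′ (e¹-rigid F F-inj F≡e¹ c∈F c′∈F)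
      where
      -- 1-constraints in a common 2-constraint are disjoint, so (x , a) rules out e³-edges
      F≡e¹ : ∀ j → Σ (Fin n × Bool) λ xa → F j ≡ e¹′ xa
      F≡e¹ j with edge-through-v³-v³ (c∈F j) (c′∈F j)
      ... | inj₁ (xa , F≡ , _)       = xa , F≡
      ... | inj₂ (C , _ , c∈C , c′∈C) = ⊥-elim (C2-disj C c c′ c∈C c′∈C c≢c′ x a a c∋xa c′∋xa)
    ... | inj₂ (C , F₀≡ , c∈C , c′∈C) with edge-through-v³-v³ (c∈F (# 1)) (c′∈F (# 1))
    ...   | inj₁ ((x , a) , _ , c∋xa , c′∋xa) = C2-disj C c c′ c∈C c′∈C c≢c′ x a a c∋xa c′∋xa
    ...   | inj₂ (C′ , F₁≡ , _) =
            columns-distinct F₀≡ F₁≡ (cong e³ (e³-rigid W W-inj (column₀ F₀≡) (column₁ F₁≡)))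

    no-shared-pair : ∀ u v → u ≢ v → (∀ j → u ∈' F j) → (∀ j → v ∈' F j) → ⊥
    no-shared-pair (v¹ _) _ _ u∈F _ = no-v¹-row u∈F
    no-shared-pair _ (v¹ _) _ _ v∈F = no-v¹-row v∈F
    no-shared-pair (v² _ _) (v² _ _) u≢v u∈F v∈F
      with edge-through-distinct-v² u≢v (u∈F (# 0)) (v∈F (# 0))
         | edge-through-distinct-v² u≢v (u∈F (# 1)) (v∈F (# 1))
    ... | _ , F₀≡ | _ , F₁≡ =
      columns-distinct F₀≡ F₁≡ (cong e² (e²-rigid W W-inj (column₀ F₀≡) (column₁ F₁≡)))
    no-shared-pair (v² _ _) (v³ _) _ u∈F v∈F =
      columns-distinct (edge-through-v²-v³ (u∈F (# 0)) (v∈F (# 0)))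
                       (edge-through-v²-v³ (u∈F (# 1)) (v∈F (# 1))) refl
    no-shared-pair (v³ _) (v² _ _) _ u∈F v∈F =
      columns-distinct (edge-through-v²-v³ (v∈F (# 0)) (u∈F (# 0)))
                       (edge-through-v²-v³ (v∈F (# 1)) (u∈F (# 1))) refl
    no-shared-pair (v³ _) (v³ _) u≢v u∈F v∈F = no-v³-v³-row (u≢v ∘ cong v³) u∈F v∈F

lemma7 : (d : ℕ) → 3 ≤ d → (I : Instance d) → SquareFree d (H' I)
lemma7 (suc (suc (suc m))) _ = no-square
lemma7 0 ()
lemma7 1 (s≤s ())
lemma7 2 (s≤s (s≤s ()))
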